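{- A substring $P$ of $T$ with $\mathsf{interval}(P)=[b,e]$ is a maximal repeat if and only if (i) $|\mathsf{children}(P)|\ge 2$ and (ii) $\mathsf{rank}(\mathcal{S}_{\mathsf{start}},b)\neq\mathsf{rank}(\mathcal{S}_{\mathsf{start}},e)$.
   Context: $T$ is a string of length $n\ge 2$ over $\Sigma=\{1,\dots,\sigma\}$ whose last character is a special character $\$$ not occurring in $T[1..n-1]$, every character of $\Sigma$ occurring in $T$. $\mathit{Occ}(T,P)$ is the set of starting positions of occurrences of $P$ in $T$. $\mathsf{SA}$ is the suffix array; $\mathsf{LF}(i)$ satisfies $\mathsf{SA}[\mathsf{LF}(i)]=\mathsf{SA}[i]-1$ (or $n$ if $\mathsf{SA}[i]=1$); the BWT is $L[i]=T[\mathsf{SA}[\mathsf{LF}(i)]]$. $\mathcal{S}_{\mathsf{start}}=\{1\}\cup\{i\in\{2,\dots,n\}: L[i]\ne L[i-1]\}$ is the set of starting positions of runs of $L$, and $\mathsf{rank}(S,i)=|\{j\in S: j\le i\}|$. $\mathsf{interval}(P)=[b,e]$ is the interval with $\{\mathsf{SA}[b],\dots,\mathsf{SA}[e]\}=\mathit{Occ}(T,P)$. $\mathsf{children}(P)=\{Pc\mid c\in\Sigma,\ Pc\text{ a substring of }T\}$. A maximal repeat is a substring $P$ with $|\mathit{Occ}(T,P)|\ge 2$ and $|\mathit{Occ}(T,cP)|,|\mathit{Occ}(T,Pc)|<|\mathit{Occ}(T,P)|$ for every $c\in\Sigma$. -}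

module Defs where

open import Data.Nat using (ℕ; zero; suc; _+_; _∸_; _≤_; _<_; _≟_; _<?_)
open import Data.Nat.Properties using (≤-refl)
open import Data.List using (List; []; _∷_; length; drop; filter; upTo; _∷ʳ_; map)
open import Data.List.Relation.Binary.Prefix.Heterogeneous using (Prefix)
open import Data.List.Relation.Binary.Prefix.Heterogeneous.Properties using (prefix?)
open import Data.List.Relation.Binary.Lex.Strict using (Lex-<)
open import Data.Product using (_×_; Σ; ∃; _,_)
open import Data.Sum using (_⊎_)
open import Relation.Binary.PropositionalEquality using (_≡_; _≢_)
open import Relation.Nullary using (¬_; Dec; yes; no)
open import Relation.Nullary.Decidable using (¬?; _×-dec_)

-- Conventions: a text is a list of natural numbers (characters),
-- positions are 1-based: position p ∈ {1,…,n} with n = length T.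

range : ℕ → ℕ → List ℕ
range a b = map (λ k → a + k) (upTo (suc b ∸ a))

suffix : List ℕ → ℕ → List ℕ
suffix T p = drop (p ∸ 1) T

-- the character T[p] (junk value 0 outside 1..n)
charAt : List ℕ → ℕ → ℕ
charAt T p with suffix T p
... | []    = 0
... | c ∷ _ = c

OccursAt : List ℕ → List ℕ → ℕ → Set
OccursAt T P p = (1 ≤ p) × (p ≤ length T) × Prefix _≡_ P (suffix T p)

occursAt? : (T P : List ℕ) (p : ℕ) → Dec (OccursAt T P p)
occursAt? T P p = (1 Data.Nat.≤? p) ×-dec ((p Data.Nat.≤? length T) ×-dec prefix? _≟_ P (suffix T p))

Occ : List ℕ → List ℕ → List ℕ
Occ T P = filter (occursAt? T P) (range 1 (length T))

#Occ : List ℕ → List ℕ → ℕ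
#Occ T P = length (Occ T P)

IsSubstring : List ℕ → List ℕ → Set
IsSubstring T P = ∃ λ p → OccursAt T P p

-- |children(P)| = |{ Pc | c ∈ Σ = {1..σ}, Pc substring of T }|
-- (Pc ↦ c is injective, so this is the number of such c)
#children : ℕ → List ℕ → List ℕ → ℕ
#children σ T P = length (filter (λ c → 1 Data.Nat.≤? #Occ T (P ∷ʳ c)) (range 1 σ))

MaximalRepeat : ℕ → List ℕ → List ℕ → Set
MaximalRepeat σ T P =
  (2 ≤ #Occ T P) ×
  (∀ c → 1 ≤ c → c ≤ σ → (#Occ T (c ∷ P) < #Occ T P) × (#Occ T (P ∷ʳ c) < #Occ T P))

_<lex_ : List ℕ → List ℕ → Set
_<lex_ = Lex-< _≡_ _<_

IsSuffixArray : List ℕ → (ℕ → ℕ) → Set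
IsSuffixArray T SA =
  (∀ i → 1 ≤ i → i ≤ length T → (1 ≤ SA i) × (SA i ≤ length T)) ×
  (∀ i j → 1 ≤ i → i ≤ length T → 1 ≤ j → j ≤ length T → SA i ≡ SA j → i ≡ j) ×
  (∀ i → 1 ≤ i → i < length T → suffix T (SA i) <lex suffix T (SA (suc i)))

-- SA[LF(i)] = SA[i] - 1, or n if SA[i] = 1
SA∘LF : List ℕ → (ℕ → ℕ) → ℕ → ℕ
SA∘LF T SA i with SA i
... | 0           = 0        -- never happens for a suffix array and 1 ≤ i ≤ n
... | 1           = length T
... | suc (suc k) = suc k

BWT : List ℕ → (ℕ → ℕ) → ℕ → ℕ
BWT T SA i = charAt T (SA∘LF T SA i)

isStart? : (T : List ℕ) (SA : ℕ → ℕ) (i : ℕ) →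
           Dec ((i ≡ 1) ⊎ ((2 ≤ i) × (i ≤ length T) × (BWT T SA i ≢ BWT T SA (i ∸ 1))))
isStart? T SA i with i ≟ 1
... | yes e = yes (Data.Sum.inj₁ e)
... | no ne with (2 Data.Nat.≤? i) ×-dec ((i Data.Nat.≤? length T) ×-dec ¬? (BWT T SA i ≟ BWT T SA (i ∸ 1)))
...   | yes q = yes (Data.Sum.inj₂ q)
...   | no nq = no λ { (Data.Sum.inj₁ e) → ne e ; (Data.Sum.inj₂ q) → nq q }

rankStart : List ℕ → (ℕ → ℕ) → ℕ → ℕ
rankStart T SA i = length (filter (isStart? T SA) (range 1 i))

IsInterval : List ℕ → (ℕ → ℕ) → List ℕ → ℕ → ℕ → Set
IsInterval T SA P b e =
  (1 ≤ b) × (b ≤ e) × (e ≤ length T) ×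
  (∀ i → b ≤ i → i ≤ e → OccursAt T P (SA i)) ×
  (∀ p → OccursAt T P p → ∃ λ i → (b ≤ i) × (i ≤ e) × (SA i ≡ p))

WellFormedText : ℕ → List ℕ → Set
WellFormedText σ T =
  (2 ≤ length T) ×
  (∀ p → 1 ≤ p → p ≤ length T → (1 ≤ charAt T p) × (charAt T p ≤ σ)) ×
  (∀ c → 1 ≤ c → c ≤ σ → ∃ λ p → (1 ≤ p) × (p ≤ length T) × (charAt T p ≡ c)) ×
  (∀ p → 1 ≤ p → p < length T → charAt T p ≢ charAt T (length T))

-- Maximality splits into a
-- right half (P occurs twice and no Pc occurs as often as P) and a left half (no cP
-- occurs as often as P), and each half matches one condition.
--
-- Right half.  Two distinct children Pc₁, Pc₂ occur at distinct positions, and each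
-- child misses the occurrence of the other one.  Conversely, since the sentinel $ occurs
-- only at the end of T, at most one occurrence of P runs into the end of T; so when P
-- occurs twice every occurrence p is followed by a character T[p+|P|], and an occurrence
-- of P missed by the child P·T[p₁+|P|] exhibits a second child.
--
-- Left half.  L[i] is the character preceding the occurrence SA[i] of P.  The ranks at b
-- and e differ iff a run of L starts in (b,e], i.e. iff L is not constant on [b,e].  If
-- L[i] ≠ c then q ↦ q+1 injects Occ(cP) into Occ(P) missing SA[i]; if L ≡ c on [b,e]
-- (and P occurs twice, so c ≠ $) every occurrence of P is preceded by c, so cP occurs as
-- often as P.
module Submission where

open import Defs
open import Data.Nat using (ℕ; zero; suc; _+_; _≤_; _<_; z≤n; s≤s; _≟_; _≤?_)
open import Data.Nat.Properties
open import Data.List using (List; []; _∷_; [_]; _++_; _∷ʳ_; length; map; filter; drop; upTo; initLast; _∷ʳ′_)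
open import Data.List.Properties using (length-map; length-++; map-++; upTo-∷ʳ; filter-++; filter-accept; filter-reject; drop-drop)
open import Data.List.Membership.Propositional using (_∈_; _∉_; find)
open import Data.List.Membership.Propositional.Properties using (∈-∃++; ∈-map⁺; ∈-map⁻; ∈-upTo⁺; ∈-filter⁺; ∈-filter⁻; ∈-length)
open import Data.List.Relation.Binary.Subset.Propositional using (_⊆_)
open import Data.List.Relation.Binary.Prefix.Heterogeneous using (Prefix; []; _∷_)
open import Data.List.Relation.Unary.Any using (here; there)
open import Data.List.Relation.Unary.All using ([]; _∷_; all?) renaming (lookup to All-lookup)
open import Data.List.Relation.Unary.All.Properties using (¬Any⇒All¬; ¬All⇒Any¬)
open import Data.List.Relation.Unary.AllPairs using ([]; _∷_)
open import Data.List.Relation.Unary.Unique.Propositional using (Unique)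
import Data.List.Relation.Unary.Unique.Propositional.Properties as Unique
open import Data.Product using (_×_; ∃; ∃₂; _,_; proj₁; proj₂)
open import Data.Sum using (_⊎_; inj₁; inj₂)
open import Function.Bundles using (_⇔_; mk⇔)
open import Level using (0ℓ)
open import Relation.Binary.PropositionalEquality hiding ([_])
open import Relation.Nullary using (¬_; yes; no; contradiction)
open import Relation.Unary using (Pred; Decidable)

-- Counting in duplicate-free lists

length-without : ∀ {x : ℕ} (as bs : List ℕ) → length (as ++ x ∷ bs) ≡ suc (length (as ++ bs))
length-without [] bs = refl
length-without (a ∷ as) bs = cong suc (length-without as bs)

∈-without : ∀ {z x : ℕ} (as bs : List ℕ) → z ∈ as ++ x ∷ bs → z ≢ x → z ∈ as ++ bs
∈-without [] bs (here refl) z≢x = contradiction refl z≢x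
∈-without [] bs (there z∈) z≢x = z∈
∈-without (a ∷ as) bs (here refl) z≢x = here refl
∈-without (a ∷ as) bs (there z∈) z≢x = there (∈-without as bs z∈ z≢x)

unique-⊆⇒≤ : ∀ {xs ys : List ℕ} → Unique xs → xs ⊆ ys → length xs ≤ length ys
unique-⊆⇒≤ [] _ = z≤n
unique-⊆⇒≤ {x ∷ xs} (x∉xs ∷ unique) xs⊆ys with as , bs , refl ← ∈-∃++ (xs⊆ys (here refl)) =
  subst (suc (length xs) ≤_) (sym (length-without as bs))
    (s≤s (unique-⊆⇒≤ unique λ z∈xs → ∈-without as bs (xs⊆ys (there z∈xs))
                                         (λ z≡x → All-lookup x∉xs z∈xs (sym z≡x))))

unique-⊂⇒< : ∀ {xs ys : List ℕ} {y} → Unique xs → xs ⊆ ys → y ∈ ys → y ∉ xs → length xs < length ys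
unique-⊂⇒< {xs} unique xs⊆ys y∈ys y∉xs =
  unique-⊆⇒≤ (¬Any⇒All¬ xs y∉xs ∷ unique) λ { (here refl) → y∈ys ; (there z∈xs) → xs⊆ys z∈xs }

distinct-members⇒2≤length : ∀ {xs : List ℕ} {x y} → x ≢ y → x ∈ xs → y ∈ xs → 2 ≤ length xs
distinct-members⇒2≤length x≢y x∈xs y∈xs =
  unique-⊆⇒≤ ((x≢y ∷ []) ∷ [] ∷ []) λ { (here refl) → x∈xs ; (there (here refl)) → y∈xs }

2≤length⇒distinct-members : ∀ {xs : List ℕ} → Unique xs → 2 ≤ length xs →
                            ∃₂ λ x y → x ≢ y × x ∈ xs × y ∈ xs
2≤length⇒distinct-members {_ ∷ []} _ (s≤s ())
2≤length⇒distinct-members {x ∷ y ∷ _} ((x≢y ∷ _) ∷ _) _ = x , y , x≢y , here refl , there (here refl)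

1≤length⇒member : ∀ {xs : List ℕ} → 1 ≤ length xs → ∃ λ x → x ∈ xs
1≤length⇒member {x ∷ _} _ = x , here refl

∈-range : ∀ {p n} → 1 ≤ p → p ≤ n → p ∈ range 1 n
∈-range {suc k} _ k<n = ∈-map⁺ suc (∈-upTo⁺ k<n)

range-unique : ∀ n → Unique (range 1 n)
range-unique n = Unique.map⁺ suc-injective (Unique.upTo⁺ n)

charAt-head : ∀ T k {x r} → suffix T k ≡ x ∷ r → charAt T k ≡ x
charAt-head T k eq with suffix T k | eq
... | _ | refl = refl

drop-nonempty⇒< : ∀ m (T : List ℕ) {x r} → drop m T ≡ x ∷ r → m < length T
drop-nonempty⇒< zero (_ ∷ _) _ = s≤s z≤n
drop-nonempty⇒< (suc m) (_ ∷ T) eq = s≤s (drop-nonempty⇒< m T eq)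

<⇒drop-nonempty : ∀ m (T : List ℕ) → m < length T → ∃₂ λ x r → drop m T ≡ x ∷ r
<⇒drop-nonempty zero (x ∷ T) _ = x , T , refl
<⇒drop-nonempty (suc m) (_ ∷ T) (s≤s m<n) = <⇒drop-nonempty m T m<n

prefix-of-suffix⇒≤ : ∀ T k {x Q} → Prefix _≡_ (x ∷ Q) (suffix T (suc k)) → suc k ≤ length T
prefix-of-suffix⇒≤ T k pr with suffix T (suc k) in eq | pr
... | _ ∷ _ | _ = drop-nonempty⇒< k T eq

prefix-++⁻ : ∀ (P : List ℕ) {Q xs} → Prefix _≡_ (P ++ Q) xs →
             Prefix _≡_ P xs × Prefix _≡_ Q (drop (length P) xs)
prefix-++⁻ [] pr = [] , pr
prefix-++⁻ (_ ∷ P) (x≡y ∷ pr) = let prP , prQ = prefix-++⁻ P pr in x≡y ∷ prP , prQ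

prefix-++⁺ : ∀ {P Q xs : List ℕ} → Prefix _≡_ P xs → Prefix _≡_ Q (drop (length P) xs) →
             Prefix _≡_ (P ++ Q) xs
prefix-++⁺ [] prQ = prQ
prefix-++⁺ (x≡y ∷ prP) prQ = x≡y ∷ prefix-++⁺ prP prQ

-- The occurrence calculus

-- P ++ Q occurs at p iff P occurs at p and Q at p + |P|; the converse needs Q nonempty,
-- since an empty Q "occurs" only at positions inside T.
occurs-++⁺ : ∀ {T P Q p} → OccursAt T P p → OccursAt T Q (p + length P) → OccursAt T (P ++ Q) p
occurs-++⁺ {T} {P} {p = suc k} (1≤p , p≤n , prP) (_ , _ , prQ) =
  1≤p , p≤n , prefix-++⁺ prP (subst (Prefix _≡_ _) (sym (drop-drop k (length P) T)) prQ)

occurs-++⁻ : ∀ {T P y Q p} → OccursAt T (P ++ y ∷ Q) p → OccursAt T P p × OccursAt T (y ∷ Q) (p + length P)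
occurs-++⁻ {T} {P} {p = suc k} (1≤p , p≤n , pr) =
  (1≤p , p≤n , prP) , s≤s z≤n , prefix-of-suffix⇒≤ T (k + length P) prQ , prQ
  where
  prP = proj₁ (prefix-++⁻ P pr)
  prQ = subst (Prefix _≡_ _) (drop-drop k (length P) T) (proj₂ (prefix-++⁻ P pr))

occurs-single⁻ : ∀ {T c k} → OccursAt T [ c ] k → charAt T k ≡ c
occurs-single⁻ {T} {k = k} (_ , _ , pr) = charAt-head T k (proj₂ (prefix-single pr))
  where
  prefix-single : ∀ {c xs} → Prefix _≡_ [ c ] xs → ∃ λ r → xs ≡ c ∷ r
  prefix-single (refl ∷ []) = _ , refl

occurs-single⁺ : ∀ {T k} → 1 ≤ k → k ≤ length T → OccursAt T [ charAt T k ] k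
occurs-single⁺ {T} {suc k} 1≤k k≤n with x , r , eq ← <⇒drop-nonempty k T k≤n =
  1≤k , k≤n , subst (Prefix _≡_ [ charAt T (suc k) ]) (sym eq) (charAt-head T (suc k) eq ∷ [])

occurs-snoc⁻ : ∀ {T P c p} → OccursAt T (P ∷ʳ c) p →
               OccursAt T P p × (p + length P ≤ length T) × (charAt T (p + length P) ≡ c)
occurs-snoc⁻ o with oP , oc ← occurs-++⁻ o = oP , proj₁ (proj₂ oc) , occurs-single⁻ oc

occurs-init : ∀ {T P c p} → OccursAt T (P ∷ʳ c) p → OccursAt T P p
occurs-init o = proj₁ (occurs-snoc⁻ o)

followed-by : ∀ {T P c p} → OccursAt T (P ∷ʳ c) p → charAt T (p + length P) ≡ c
followed-by o = proj₂ (proj₂ (occurs-snoc⁻ o))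

occurs-snoc⁺ : ∀ {T P p} → OccursAt T P p → p + length P ≤ length T →
               OccursAt T (P ∷ʳ charAt T (p + length P)) p
occurs-snoc⁺ {P = P} {p} oP bound =
  occurs-++⁺ oP (occurs-single⁺ (≤-trans (proj₁ oP) (m≤m+n p (length P))) bound)

occurs-cons⁻ : ∀ {T c x P q} → OccursAt T (c ∷ x ∷ P) q → (charAt T q ≡ c) × OccursAt T (x ∷ P) (suc q)
occurs-cons⁻ {T} {x = x} {P} {q} o with oc , oP ← occurs-++⁻ {P = [ _ ]} o =
  occurs-single⁻ oc , subst (OccursAt T (x ∷ P)) (+-comm q 1) oP

occurs-cons⁺ : ∀ {T P q} → 1 ≤ q → OccursAt T P (suc q) → OccursAt T (charAt T q ∷ P) q
occurs-cons⁺ {T} {P} {q} 1≤q oP@(_ , q<n , _) =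
  occurs-++⁺ (occurs-single⁺ 1≤q (<⇒≤ q<n)) (subst (OccursAt T P) (+-comm 1 q) oP)

-- Counting occurrences

∈Occ⁺ : ∀ {T P p} → OccursAt T P p → p ∈ Occ T P
∈Occ⁺ {T} {P} o@(1≤p , p≤n , _) = ∈-filter⁺ (occursAt? T P) (∈-range 1≤p p≤n) o

∈Occ⁻ : ∀ {T P p} → p ∈ Occ T P → OccursAt T P p
∈Occ⁻ {T} {P} p∈ = proj₂ (∈-filter⁻ (occursAt? T P) {xs = range 1 (length T)} p∈)

Occ-unique : ∀ T P → Unique (Occ T P)
Occ-unique T P = Unique.filter⁺ (occursAt? T P) (range-unique (length T))

#Occ-≤ : ∀ {T P Q} (f : ℕ → ℕ) → (∀ {p} → OccursAt T P p → ∃ λ q → OccursAt T Q q × f q ≡ p) →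
         #Occ T P ≤ #Occ T Q
#Occ-≤ {T} {P} {Q} f covered =
  subst (#Occ T P ≤_) (length-map f (Occ T Q)) (unique-⊆⇒≤ (Occ-unique T P) image)
  where
  image : Occ T P ⊆ map f (Occ T Q)
  image p∈ with q , oQ , refl ← covered (∈Occ⁻ p∈) = ∈-map⁺ f (∈Occ⁺ oQ)

#Occ-< : ∀ {T P Q p} (f : ℕ → ℕ) → (∀ {x y} → f x ≡ f y → x ≡ y) →
         (∀ {q} → OccursAt T Q q → OccursAt T P (f q)) → OccursAt T P p →
         (∀ {q} → OccursAt T Q q → f q ≢ p) → #Occ T Q < #Occ T P
#Occ-< {T} {P} {Q} f injective into oP missed =
  subst (_< #Occ T P) (length-map f (Occ T Q))
    (unique-⊂⇒< (Unique.map⁺ injective (Occ-unique T Q)) image (∈Occ⁺ oP) notImage)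
  where
  image : map f (Occ T Q) ⊆ Occ T P
  image fq∈ with q , q∈ , refl ← ∈-map⁻ f fq∈ = ∈Occ⁺ (into (∈Occ⁻ q∈))
  notImage : _ ∉ map f (Occ T Q)
  notImage p∈ with q , q∈ , refl ← ∈-map⁻ f p∈ = missed (∈Occ⁻ q∈) refl

#Occ-<⇒missed : ∀ {T P Q} → #Occ T Q < #Occ T P → ∃ λ p → OccursAt T P p × ¬ OccursAt T Q p
#Occ-<⇒missed {T} {P} {Q} fewer with all? (occursAt? T Q) (Occ T P)
... | yes allQ = contradiction (#Occ-≤ (λ p → p) λ oP → _ , All-lookup allQ (∈Occ⁺ oP) , refl) (<⇒≱ fewer)
... | no notAllQ with p , p∈ , ¬oQ ← find (¬All⇒Any¬ (occursAt? T Q) (Occ T P) notAllQ) = p , ∈Occ⁻ p∈ , ¬oQ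

2≤#Occ⁺ : ∀ {T P p p'} → p ≢ p' → OccursAt T P p → OccursAt T P p' → 2 ≤ #Occ T P
2≤#Occ⁺ p≢p' o o' = distinct-members⇒2≤length p≢p' (∈Occ⁺ o) (∈Occ⁺ o')

2≤#Occ⁻ : ∀ {T P} → 2 ≤ #Occ T P → ∃₂ λ p p' → p ≢ p' × OccursAt T P p × OccursAt T P p'
2≤#Occ⁻ {T} {P} twice with p , p' , p≢p' , p∈ , p'∈ ← 2≤length⇒distinct-members (Occ-unique T P) twice =
  p , p' , p≢p' , ∈Occ⁻ p∈ , ∈Occ⁻ p'∈

Children : ℕ → List ℕ → List ℕ → List ℕ
Children σ T P = filter (λ c → 1 ≤? #Occ T (P ∷ʳ c)) (range 1 σ)

child-∈ : ∀ {σ T P c q} → 1 ≤ c → c ≤ σ → OccursAt T (P ∷ʳ c) q → c ∈ Children σ T P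
child-∈ {T = T} {P} 1≤c c≤σ o = ∈-filter⁺ (λ c → 1 ≤? #Occ T (P ∷ʳ c)) (∈-range 1≤c c≤σ) (∈-length (∈Occ⁺ o))

∈-child : ∀ {σ T P c} → c ∈ Children σ T P → ∃ λ q → OccursAt T (P ∷ʳ c) q
∈-child {σ} {T} {P} c∈ with q , q∈ ← 1≤length⇒member (proj₂ (∈-filter⁻ (λ c → 1 ≤? #Occ T (P ∷ʳ c)) {xs = range 1 σ} c∈)) =
  q , ∈Occ⁻ q∈

Children-unique : ∀ σ T P → Unique (Children σ T P)
Children-unique σ T P = Unique.filter⁺ (λ c → 1 ≤? #Occ T (P ∷ʳ c)) (range-unique σ)

-- Ranks of a decidable set of positions

module Rank {S : Pred ℕ 0ℓ} (S? : Decidable S) where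

  rank : ℕ → ℕ
  rank i = length (filter S? (range 1 i))

  rank-suc : ∀ k → rank (suc k) ≡ rank k + length (filter S? [ suc k ])
  rank-suc k = begin
    rank (suc k)                                             ≡⟨ cong (λ xs → length (filter S? xs)) range-suc ⟩
    length (filter S? (range 1 k ++ [ suc k ]))              ≡⟨ cong length (filter-++ S? (range 1 k) [ suc k ]) ⟩
    length (filter S? (range 1 k) ++ filter S? [ suc k ])    ≡⟨ length-++ (filter S? (range 1 k)) ⟩
    rank k + length (filter S? [ suc k ])                    ∎
    where
    open ≡-Reasoning
    range-suc : range 1 (suc k) ≡ range 1 k ++ [ suc k ]
    range-suc = trans (cong (map suc) (sym (upTo-∷ʳ k))) (map-++ suc (upTo k) [ k ])

  rank-step-in : ∀ {k} → S (suc k) → rank (suc k) ≡ suc (rank k)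
  rank-step-in {k} s =
    trans (rank-suc k) (trans (cong (λ xs → rank k + length xs) (filter-accept S? {xs = []} s)) (+-comm (rank k) 1))

  rank-step-out : ∀ {k} → ¬ S (suc k) → rank (suc k) ≡ rank k
  rank-step-out {k} ¬s =
    trans (rank-suc k) (trans (cong (λ xs → rank k + length xs) (filter-reject S? {xs = []} ¬s)) (+-identityʳ (rank k)))

  rank-mono : ∀ {m k} → m ≤ k → rank m ≤ rank k
  rank-mono {k = zero} z≤n = ≤-refl
  rank-mono {m} {suc k} m≤k with m≤n⇒m<n∨m≡n m≤k | S? (suc k)
  ... | inj₂ refl | _ = ≤-refl
  ... | inj₁ (s≤s m≤k') | yes s = ≤-trans (rank-mono m≤k') (≤-trans (n≤1+n (rank k)) (≤-reflexive (sym (rank-step-in s))))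
  ... | inj₁ (s≤s m≤k') | no ¬s = ≤-trans (rank-mono m≤k') (≤-reflexive (sym (rank-step-out ¬s)))

  rank-strict : ∀ {b j e} → b < j → j ≤ e → S j → rank b < rank e
  rank-strict {b} {suc j} (s≤s b≤j) j<e s =
    ≤-trans (s≤s (rank-mono b≤j)) (≤-trans (≤-reflexive (sym (rank-step-in s))) (rank-mono j<e))

  rank-differs⇒member : ∀ {b e} → b ≤ e → rank b ≢ rank e → ∃ λ j → (b < j) × (j ≤ e) × S j
  rank-differs⇒member {e = zero} z≤n differ = contradiction refl differ
  rank-differs⇒member {b} {suc e} b≤e differ with m≤n⇒m<n∨m≡n b≤e | S? (suc e)
  ... | inj₂ refl | _ = contradiction refl differ
  ... | inj₁ b<se | yes s = suc e , b<se , ≤-refl , s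
  ... | inj₁ (s≤s b≤e') | no ¬s
    with j , b<j , j≤e , s ← rank-differs⇒member b≤e' (λ same → differ (trans same (sym (rank-step-out ¬s)))) =
    j , b<j , m≤n⇒m≤1+n j≤e , s

-- The BWT

bwt-preceding : ∀ T SA i → 1 ≤ SA i →
  (SA i ≡ 1 × BWT T SA i ≡ charAt T (length T)) ⊎ (∃ λ q → (1 ≤ q) × (SA i ≡ suc q) × (BWT T SA i ≡ charAt T q))
bwt-preceding T SA i 1≤SAi with SA i | 1≤SAi
... | suc zero | _ = inj₁ (refl , refl)
... | suc (suc q) | _ = inj₂ (suc q , s≤s z≤n , refl , refl)

bwt-predecessor : ∀ {T SA i q} → 1 ≤ q → SA i ≡ suc q → BWT T SA i ≡ charAt T q
bwt-predecessor {T} {SA} {i} 1≤q SAi≡sq with bwt-preceding T SA i (subst (1 ≤_) (sym SAi≡sq) (s≤s z≤n))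
... | inj₁ (SAi≡1 , _) = contradiction (subst (1 ≤_) (suc-injective (trans (sym SAi≡sq) SAi≡1)) 1≤q) λ ()
... | inj₂ (q' , _ , SAi≡sq' , Li≡Tq') = trans Li≡Tq' (cong (charAt T) (suc-injective (trans (sym SAi≡sq') SAi≡sq)))

-- Facts about a well-formed text: characters lie in Σ and the sentinel $ = T[n] is unique

module WellFormed {σ : ℕ} {T : List ℕ} (wf : WellFormedText σ T) where

  n : ℕ
  n = length T

  char-in-Σ : ∀ {k} → 1 ≤ k → k ≤ n → (1 ≤ charAt T k) × (charAt T k ≤ σ)
  char-in-Σ = proj₁ (proj₂ wf) _

  sentinel-unique : ∀ {k} → 1 ≤ k → k ≤ n → charAt T k ≡ charAt T n → k ≡ n
  sentinel-unique 1≤k k≤n is$ with m≤n⇒m<n∨m≡n k≤n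
  ... | inj₁ k<n = contradiction is$ (proj₂ (proj₂ (proj₂ wf)) _ 1≤k k<n)
  ... | inj₂ k≡n = k≡n

  -- At most one occurrence of P runs into the end of T: its last character would be $.
  overhanging-unique : ∀ {P p p'} → OccursAt T P p → OccursAt T P p' → ¬ (p + length P ≤ n) → p' ≡ p
  overhanging-unique {P} {p} {p'} o o' overhangs with initLast P
  ... | [] = contradiction (subst (_≤ n) (sym (+-identityʳ p)) (proj₁ (proj₂ o))) overhangs
  ... | P' ∷ʳ′ d with _ , fits , is-d ← occurs-snoc⁻ {P = P'} o
                   | _ , fits' , is-d' ← occurs-snoc⁻ {P = P'} o' =
    +-cancelʳ-≡ (length P') p' p (trans ends' (sym ends))
    where
    ends : p + length P' ≡ n
    ends = ≤-antisym fits (≮⇒≥ λ short → overhangs (subst (_≤ n) +-suc-length short))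
      where
      +-suc-length : suc (p + length P') ≡ p + length (P' ∷ʳ d)
      +-suc-length = begin
        suc (p + length P')      ≡⟨ sym (+-suc p (length P')) ⟩
        p + suc (length P')      ≡⟨ cong (p +_) (+-comm 1 (length P')) ⟩
        p + (length P' + 1)      ≡⟨ cong (p +_) (sym (length-++ P')) ⟩
        p + length (P' ∷ʳ d)     ∎
        where open ≡-Reasoning
    ends' : p' + length P' ≡ n
    ends' = sentinel-unique (≤-trans (proj₁ o') (m≤m+n p' (length P'))) fits'
              (trans is-d' (trans (sym is-d) (cong (charAt T) ends)))

  -- No character occurs at every position of T, since T[1] ≠ T[n] = $.
  position-without : ∀ c → ∃ λ w → (1 ≤ w) × (w ≤ n) × (charAt T w ≢ c)
  position-without c with charAt T 1 ≟ c
  ... | no T[1]≢c = 1 , ≤-refl , <⇒≤ (proj₁ wf) , T[1]≢c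
  ... | yes T[1]≡c = n , <⇒≤ (proj₁ wf) , ≤-refl ,
                     λ T[n]≡c → proj₂ (proj₂ (proj₂ wf)) 1 ≤-refl (proj₁ wf) (trans T[1]≡c (sym T[n]≡c))

  single-char-rarer : ∀ c → #Occ T [ c ] < #Occ T []
  single-char-rarer c with w , 1≤w , w≤n , T[w]≢c ← position-without c =
    #Occ-< (λ p → p) (λ eq → eq) (λ (1≤q , q≤n , _) → 1≤q , q≤n , []) (1≤w , w≤n , [])
      (λ o q≡w → T[w]≢c (subst (λ k → charAt T k ≡ c) q≡w (occurs-single⁻ o)))

  bwt-in-Σ : ∀ {SA i} → 1 ≤ SA i → SA i ≤ n → (1 ≤ BWT T SA i) × (BWT T SA i ≤ σ)
  bwt-in-Σ {SA} {i} 1≤SAi SAi≤n with bwt-preceding T SA i 1≤SAi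
  ... | inj₁ (_ , Li≡$) = subst (λ c → (1 ≤ c) × (c ≤ σ)) (sym Li≡$) (char-in-Σ (<⇒≤ (proj₁ wf)) ≤-refl)
  ... | inj₂ (q , 1≤q , SAi≡sq , Li≡Tq) =
    subst (λ c → (1 ≤ c) × (c ≤ σ)) (sym Li≡Tq) (char-in-Σ 1≤q (<⇒≤ (subst (_≤ n) SAi≡sq SAi≤n)))

  bwt-sentinel : ∀ {SA i} → 1 ≤ SA i → SA i ≤ n → BWT T SA i ≡ charAt T n → SA i ≡ 1
  bwt-sentinel {SA} {i} 1≤SAi SAi≤n Li≡$ with bwt-preceding T SA i 1≤SAi
  ... | inj₁ (SAi≡1 , _) = SAi≡1
  ... | inj₂ (q , 1≤q , SAi≡sq , Li≡Tq) =
    contradiction (subst (suc q ≤_) (sym (sentinel-unique 1≤q q≤n (trans (sym Li≡Tq) Li≡$))) q<n) (n≮n q)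
    where
    q<n : q < n
    q<n = subst (_≤ n) SAi≡sq SAi≤n
    q≤n : q ≤ n
    q≤n = <⇒≤ q<n

-- The right half of maximality

-- A child Pc misses every occurrence of P followed by a different character c'.
child-rarer : ∀ {T P c c' q} → c' ≢ c → OccursAt T (P ∷ʳ c') q → #Occ T (P ∷ʳ c) < #Occ T P
child-rarer {T} {P} {c} c'≢c o' =
  #Occ-< (λ p → p) (λ eq → eq) occurs-init (occurs-init o')
    (λ o same → c'≢c (trans (sym (followed-by o')) (subst (λ p → charAt T (p + length P) ≡ c) same (followed-by o))))

-- Two children c₁ ≠ c₂ occur at distinct positions, and every child misses one of them.
two-children⇒right-maximal : ∀ {σ T P} → 2 ≤ #children σ T P →
                             (2 ≤ #Occ T P) × (∀ c → #Occ T (P ∷ʳ c) < #Occ T P)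
two-children⇒right-maximal {σ} {T} {P} two
  with c₁ , c₂ , c₁≢c₂ , c₁∈ , c₂∈ ← 2≤length⇒distinct-members (Children-unique σ T P) two
  with q₁ , o₁ ← ∈-child {σ} c₁∈ | q₂ , o₂ ← ∈-child {σ} c₂∈ =
  2≤#Occ⁺ q₁≢q₂ (occurs-init o₁) (occurs-init o₂) , rarer
  where
  q₁≢q₂ : q₁ ≢ q₂
  q₁≢q₂ refl = c₁≢c₂ (trans (sym (followed-by o₁)) (followed-by o₂))
  rarer : ∀ c → #Occ T (P ∷ʳ c) < #Occ T P
  rarer c with c ≟ c₁
  ... | yes refl = child-rarer {T} {P} (λ c₂≡c₁ → c₁≢c₂ (sym c₂≡c₁)) o₂
  ... | no c≢c₁ = child-rarer {T} {P} (λ c₁≡c → c≢c₁ (sym c₁≡c)) o₁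

module RightMaximality {σ : ℕ} {T : List ℕ} (wf : WellFormedText σ T) where
  open WellFormed wf

  followed : ∀ {P p₁ p₂ p} → p₁ ≢ p₂ → OccursAt T P p₁ → OccursAt T P p₂ → OccursAt T P p → p + length P ≤ n
  followed {P} {p = p} p₁≢p₂ o₁ o₂ o with p + length P ≤? n
  ... | yes fits = fits
  ... | no overhangs = contradiction (trans (overhanging-unique o o₁ overhangs) (sym (overhanging-unique o o₂ overhangs))) p₁≢p₂

  -- The next characters after the occurrences of P are children; an occurrence missed by
  -- the child of the first occurrence is followed by a second child.
  right-maximal⇒two-children : ∀ {P} → 2 ≤ #Occ T P → (∀ c → 1 ≤ c → c ≤ σ → #Occ T (P ∷ʳ c) < #Occ T P) →
                               2 ≤ #children σ T P
  right-maximal⇒two-children {P} twice rarer with p₁ , p₂ , p₁≢p₂ , o₁ , o₂ ← 2≤#Occ⁻ twice =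
    distinct-members⇒2≤length c₁≢c' (child o₁) (child o')
    where
    next : ℕ → ℕ
    next p = charAt T (p + length P)
    fits : ∀ {p} → OccursAt T P p → p + length P ≤ n
    fits = followed p₁≢p₂ o₁ o₂
    next-in-Σ : ∀ {p} → OccursAt T P p → (1 ≤ next p) × (next p ≤ σ)
    next-in-Σ {p} o = char-in-Σ (≤-trans (proj₁ o) (m≤m+n p (length P))) (fits o)
    child : ∀ {p} → OccursAt T P p → next p ∈ Children σ T P
    child o = child-∈ {σ} (proj₁ (next-in-Σ o)) (proj₂ (next-in-Σ o)) (occurs-snoc⁺ o (fits o))
    missed : ∃ λ p → OccursAt T P p × ¬ OccursAt T (P ∷ʳ next p₁) p
    missed = #Occ-<⇒missed (rarer (next p₁) (proj₁ (next-in-Σ o₁)) (proj₂ (next-in-Σ o₁)))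
    p' : ℕ
    p' = proj₁ missed
    o' : OccursAt T P p'
    o' = proj₁ (proj₂ missed)
    c₁≢c' : next p₁ ≢ next p'
    c₁≢c' same = proj₂ (proj₂ missed) (subst (λ c → OccursAt T (P ∷ʳ c) p') (sym same) (occurs-snoc⁺ o' (fits o')))

-- The left half of maximality

-- cP occurs less often than P as soon as some occurrence of P is not preceded by c
-- (for P = [] this holds outright, by the sentinel).
left-extension-rarer : ∀ {σ T} → WellFormedText σ T → ∀ P c {p} → OccursAt T P p →
                       (∀ {q} → 1 ≤ q → suc q ≡ p → charAt T q ≢ c) → #Occ T (c ∷ P) < #Occ T P
left-extension-rarer wf [] c _ _ = WellFormed.single-char-rarer wf c
left-extension-rarer wf (_ ∷ P) c o not-preceded =
  #Occ-< suc suc-injective (λ o' → proj₂ (occurs-cons⁻ o')) o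
    (λ o' same → not-preceded (proj₁ o') same (proj₁ (occurs-cons⁻ o')))

module LeftMaximality {σ : ℕ} {T : List ℕ} (wf : WellFormedText σ T)
                      {SA : ℕ → ℕ} {P : List ℕ} {b e : ℕ} (iv : IsInterval T SA P b e) where
  open WellFormed wf
  open Rank (isStart? T SA)

  L : ℕ → ℕ
  L = BWT T SA

  1≤b : 1 ≤ b
  1≤b = proj₁ iv

  e≤n : e ≤ n
  e≤n = proj₁ (proj₂ (proj₂ iv))

  row-occurs : ∀ {i} → b ≤ i → i ≤ e → OccursAt T P (SA i)
  row-occurs = proj₁ (proj₂ (proj₂ (proj₂ iv))) _

  row-of : ∀ {p} → OccursAt T P p → ∃ λ i → (b ≤ i) × (i ≤ e) × (SA i ≡ p)
  row-of = proj₂ (proj₂ (proj₂ (proj₂ iv))) _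

  -- A run of L starting in (b,e] makes L take two values on [b,e].
  rank-differs⇒L-varies : rank b ≢ rank e → ∀ c → ∃ λ i → (b ≤ i) × (i ≤ e) × (L i ≢ c)
  rank-differs⇒L-varies differ c with rank-differs⇒member (proj₁ (proj₂ iv)) differ
  ... | suc j , s≤s b≤j , _ , inj₁ refl = contradiction (≤-trans 1≤b b≤j) λ ()
  ... | suc j , s≤s b≤j , sj≤e , inj₂ (_ , _ , Lsj≢Lj) with L (suc j) ≟ c
  ...   | no Lsj≢c = suc j , m≤n⇒m≤1+n b≤j , sj≤e , Lsj≢c
  ...   | yes Lsj≡c = j , b≤j , ≤-trans (n≤1+n j) sj≤e , λ Lj≡c → Lsj≢Lj (trans Lsj≡c (sym Lj≡c))

  -- Without a run start in (b,e], L is constant on [b,e].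
  rank-equal⇒L-constant : rank b ≡ rank e → ∀ i → b ≤ i → i ≤ e → L i ≡ L b
  rank-equal⇒L-constant same zero b≤0 _ = contradiction (≤-trans 1≤b b≤0) λ ()
  rank-equal⇒L-constant same (suc i) b≤si si≤e with m≤n⇒m<n∨m≡n b≤si
  ... | inj₂ refl = refl
  ... | inj₁ (s≤s b≤i) with L (suc i) ≟ L i
  ...   | yes Lsi≡Li = trans Lsi≡Li (rank-equal⇒L-constant same i b≤i (≤-trans (n≤1+n i) si≤e))
  ...   | no Lsi≢Li = contradiction same (<⇒≢ (rank-strict (s≤s b≤i) si≤e run-start))
    where
    run-start : (suc i ≡ 1) ⊎ ((2 ≤ suc i) × (suc i ≤ n) × (L (suc i) ≢ L i))
    run-start = inj₂ (s≤s (≤-trans 1≤b b≤i) , ≤-trans si≤e e≤n , Lsi≢Li)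

  -- If L[i] ≠ c for some row i, the occurrence SA[i] of P is not preceded by c.
  rank-distinct⇒left-maximal : rank b ≢ rank e → ∀ c → #Occ T (c ∷ P) < #Occ T P
  rank-distinct⇒left-maximal differ c with i , b≤i , i≤e , Li≢c ← rank-differs⇒L-varies differ c =
    left-extension-rarer wf P c (row-occurs b≤i i≤e)
      (λ 1≤q sq≡SAi Tq≡c → Li≢c (trans (bwt-predecessor {T} {SA} 1≤q (sym sq≡SAi)) Tq≡c))

  -- If L ≡ c on [b,e], then c ≠ $ (P occurs twice, $ marks one row) and every occurrence
  -- of P is preceded by c, so cP occurs as often as P.
  left-maximal⇒rank-distinct : 2 ≤ #Occ T P → (∀ c → 1 ≤ c → c ≤ σ → #Occ T (c ∷ P) < #Occ T P) →
                               rank b ≢ rank e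
  left-maximal⇒rank-distinct twice rarer same =
    contradiction (#Occ-≤ suc preceded) (<⇒≱ (rarer c (proj₁ c-in-Σ) (proj₂ c-in-Σ)))
    where
    c : ℕ
    c = L b
    row-bounds : ∀ {i} → b ≤ i → i ≤ e → (1 ≤ SA i) × (SA i ≤ n)
    row-bounds b≤i i≤e = let 1≤p , p≤n , _ = row-occurs b≤i i≤e in 1≤p , p≤n
    c-in-Σ : (1 ≤ c) × (c ≤ σ)
    c-in-Σ = let 1≤p , p≤n = row-bounds ≤-refl (proj₁ (proj₂ iv)) in bwt-in-Σ {SA} 1≤p p≤n
    constant : ∀ {i} → b ≤ i → i ≤ e → L i ≡ c
    constant = rank-equal⇒L-constant same _
    row-of-$ : ∀ {p} → OccursAt T P p → c ≡ charAt T n → p ≡ 1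
    row-of-$ o c≡$ with i , b≤i , i≤e , refl ← row-of o =
      let 1≤p , p≤n = row-bounds b≤i i≤e in bwt-sentinel {SA} 1≤p p≤n (trans (constant b≤i i≤e) c≡$)
    c≢$ : c ≢ charAt T n
    c≢$ c≡$ with p₁ , p₂ , p₁≢p₂ , o₁ , o₂ ← 2≤#Occ⁻ twice =
      p₁≢p₂ (trans (row-of-$ o₁ c≡$) (sym (row-of-$ o₂ c≡$)))
    preceded : ∀ {p} → OccursAt T P p → ∃ λ q → OccursAt T (c ∷ P) q × suc q ≡ p
    preceded o with i , b≤i , i≤e , refl ← row-of o | bwt-preceding T SA i (proj₁ o)
    ... | inj₁ (_ , Li≡$) = contradiction (trans (sym (constant b≤i i≤e)) Li≡$) c≢$
    ... | inj₂ (q , 1≤q , SAi≡sq , Li≡Tq) =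
      q , subst (λ d → OccursAt T (d ∷ P) q) (trans (sym Li≡Tq) (constant b≤i i≤e))
            (occurs-cons⁺ 1≤q (subst (OccursAt T P) SAi≡sq o)) , sym SAi≡sq

corollary7 : (σ : ℕ) (T : List ℕ) (SA : ℕ → ℕ) (P : List ℕ) (b e : ℕ) →
    WellFormedText σ T → IsSuffixArray T SA →
    IsSubstring T P → IsInterval T SA P b e →
    MaximalRepeat σ T P ⇔ ((2 ≤ #children σ T P) × (rankStart T SA b ≢ rankStart T SA e))
corollary7 σ T SA P b e wf _ _ iv = mk⇔ maximal⇒conditions conditions⇒maximal
  where
  open RightMaximality wf
  open LeftMaximality wf iv

  maximal⇒conditions : MaximalRepeat σ T P → (2 ≤ #children σ T P) × (rankStart T SA b ≢ rankStart T SA e)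
  maximal⇒conditions (twice , rarer) =
    right-maximal⇒two-children twice (λ c 1≤c c≤σ → proj₂ (rarer c 1≤c c≤σ)) ,
    left-maximal⇒rank-distinct twice (λ c 1≤c c≤σ → proj₁ (rarer c 1≤c c≤σ))

  conditions⇒maximal : (2 ≤ #children σ T P) × (rankStart T SA b ≢ rankStart T SA e) → MaximalRepeat σ T P
  conditions⇒maximal (two , differ) =
    let twice , right-rarer = two-children⇒right-maximal {σ} {T} {P} two
    in twice , λ c _ _ → rank-distinct⇒left-maximal differ c , right-rarer c
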